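{- Let $H$ be a finite digraph possibly with loops, $D$ a finite $H$-colored digraph without loops and without isolated vertices, and $\xi=\{C_1,\dots,C_k\}$ ($k\ge2$) a partition of $V(H)$ such that for every $i$ the set $A_i=\{a\in A(D):c(a)\in C_i\}$ is nonempty and $G_i=D[A_i]$ is transitive by $H$-paths. Suppose that (1) for every cycle $\gamma$ in $D$ there exists $i\in\{1,\dots,k\}$ such that $\gamma$ is contained in $G_i$, and (2) for every $H$-walk $P$ in $D$ there exists $j\in\{1,\dots,k\}$ such that $P$ is contained in $G_j$. Then there is no infinite sequence of vertices $(x_0,x_1,x_2,\dots)$ such that for every $i\ge0$ there exists an $x_ix_{i+1}$-$H$-path in $D$ and there exists no $x_{i+1}x_i$-$H$-path in $D$.
   Context: Paths, walks and cycles are directed; a path has pairwise distinct vertices. $D$ is $H$-colored if it has an arc coloring $c:A(D)\to V(H)$. A walk $(v_0,\dots,v_n)$ is an $H$-walk if $(c(v_0,v_1),\dots,c(v_{n-1},v_n))$ is a walk in $H$ (a single arc is an $H$-walk); an $H$-path is a path that is an $H$-walk. $D[A]$ for an arc set $A$ is the subdigraph with arc set $A$ and vertex set the ends of arcs in $A$. A subdigraph $G$ is transitive by $H$-paths if an $xy$-$H$-path contained in $G$ and a $yz$-$H$-path contained in $G$ imply an $xz$-$H$-path contained in $G$. -}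

module Defs where

open import Data.Nat using (ℕ; _≤_)
open import Data.Fin using (Fin)
open import Data.Bool using (Bool; true; false)
open import Data.List using (List; []; _∷_; _++_; [_]; length)
open import Data.List.Relation.Unary.All using (All)
open import Data.List.Relation.Unary.Unique.Propositional using (Unique)
open import Data.Product using (Σ; ∃; _×_; _,_)
open import Relation.Binary.PropositionalEquality using (_≡_; _≢_)
open import Relation.Nullary using (¬_)

-- A finite digraph on vertex set Fin n, given by its (decidable) arc relation.
-- (Simple digraph: at most one arc (u,v) for each ordered pair.)
Digraph : ℕ → Set
Digraph n = Fin n → Fin n → Bool

pairs : {A : Set} → List A → List (A × A)
pairs (x ∷ y ∷ r) = (x , y) ∷ pairs (y ∷ r)
pairs _ = []

triples : {A : Set} → List A → List (A × A × A)
triples (x ∷ y ∷ z ∷ r) = (x , y , z) ∷ triples (y ∷ z ∷ r)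
triples _ = []

module _ {n m : ℕ} (D : Digraph n) (H : Digraph m) (c : Fin n → Fin n → Fin m) where
  -- c u v is the colour of the arc (u,v) (only meaningful when D u v ≡ true)

  IsWalk : List (Fin n) → Set
  IsWalk l = (2 ≤ length l) × All (λ { (u , v) → D u v ≡ true }) (pairs l)

  IsHWalk : List (Fin n) → Set
  IsHWalk l = IsWalk l × All (λ { (u , v , w) → H (c u v) (c v w) ≡ true }) (triples l)

  IsHPath : List (Fin n) → Set
  IsHPath l = IsHWalk l × Unique l

  HPathIn : (Fin n → Fin n → Set) → Fin n → Fin n → Set
  HPathIn P x y = Σ (List (Fin n)) λ mid →
    IsHPath (x ∷ mid ++ [ y ]) × All (λ { (u , v) → P u v }) (pairs (x ∷ mid ++ [ y ]))

  HPath : Fin n → Fin n → Set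
  HPath x y = Σ (List (Fin n)) λ mid → IsHPath (x ∷ mid ++ [ y ])

  IsCycle : List (Fin n) → Set
  IsCycle l = Σ (Fin n) λ x → Σ (List (Fin n)) λ mid →
    (l ≡ x ∷ mid ++ [ x ]) × IsWalk l × Unique (x ∷ mid)

  module _ {k : ℕ} (part : Fin m → Fin k) where
    -- partition ξ = {C_1,…,C_k}: C_i = { h | part h ≡ i }
    -- arc (u,v) belongs to A_i
    InA : Fin k → Fin n → Fin n → Set
    InA i u v = (D u v ≡ true) × (part (c u v) ≡ i)

    ContainedIn : Fin k → List (Fin n) → Set
    ContainedIn i l = All (λ { (u , v) → part (c u v) ≡ i }) (pairs l)

    TransitiveByHPaths : Fin k → Set
    TransitiveByHPaths i = ∀ x y z → x ≢ z →
      HPathIn (λ u v → part (c u v) ≡ i) x y →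
      HPathIn (λ u v → part (c u v) ≡ i) y z →
      HPathIn (λ u v → part (c u v) ≡ i) x z

-- Each step x_l → x_(l+1) of such a sequence is an H-path inside a single class G_i, by (2).
-- Along a maximal run of steps of one class i, transitivity of G_i and the absence of backward
-- H-paths make the visited vertices pairwise distinct, so a run has fewer than n steps.
-- Joining, run after run, the i-path from the start to the end of each run yields a walk in D
-- which is in fact a path: at the first repeated vertex it would close a cycle entering the
-- junction vertex by an arc of the previous class and leaving it by arcs of class i, against (1).
-- A path has fewer than n vertices, so fewer than n runs occur, and the sequence stops after
-- fewer than n * n + n steps.
module Submission where

open import Defs
open import Data.Nat using (ℕ; zero; suc; _+_; _*_; _≤_; _<_; z≤n; s≤s; s≤s⁻¹)
open import Data.Nat.Properties
  using (≤-trans; <⇒≤; <-irrefl; n<1+n; m≤n⇒m<n∨m≡n; +-mono-≤; +-mono-<-≤; *-monoˡ-≤)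
open import Data.Bool using (true; false)
open import Data.Fin using (Fin; _≟_)
open import Data.Fin.Properties using (injective⇒≤)
open import Data.List using (List; []; _∷_; _++_; [_]; length; lookup)
open import Data.List.Properties using (++-assoc; length-applyUpTo; length-++-sucʳ; length-++-≤ˡ; length-++-≤ʳ)
open import Data.List.Relation.Unary.All as All using (All; []; _∷_)
import Data.List.Relation.Unary.All.Properties as All
open import Data.List.Relation.Unary.Any using (here; there)
open import Data.List.Relation.Unary.First as First using (first)
open import Data.List.Relation.Unary.First.Properties using (toView)
open import Data.List.Relation.Unary.Unique.Propositional using (Unique; []; _∷_)
import Data.List.Relation.Unary.Unique.Propositional.Properties as Unique
open import Data.List.Membership.Propositional using (_∈_; _∉_)
open import Data.List.Membership.Propositional.Properties using (∈-∃++; ∈-++⁺ʳ; ∈-++⁻; ∈-lookup)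
open import Data.Empty using (⊥; ⊥-elim)
open import Data.Product using (Σ; ∃; _×_; _,_; proj₁; proj₂)
import Data.Product as Product
open import Data.Sum using (_⊎_; inj₁; inj₂)
import Data.Sum as Sum
open import Function using (_∘_)
open import Function.Definitions using (Injective; Surjective)
open import Relation.Binary.PropositionalEquality using (_≡_; _≢_; refl; sym; trans; cong; subst)
open import Relation.Nullary using (¬_; yes; no)
open import Relation.Nullary.Decidable using (toSum)

module _ {A : Set} where

  pairs-++-∷ : (xs : List A) (z : A) (ys : List A) →
               pairs (xs ++ z ∷ ys) ≡ pairs (xs ++ [ z ]) ++ pairs (z ∷ ys)
  pairs-++-∷ []           z ys = refl
  pairs-++-∷ (x ∷ [])     z ys = refl
  pairs-++-∷ (x ∷ y ∷ xs) z ys = cong ((x , y) ∷_) (pairs-++-∷ (y ∷ xs) z ys)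

  module _ {P : A × A → Set} where

    All-pairs-++-∷⁻ : ∀ xs (z : A) ys → All P (pairs (xs ++ z ∷ ys)) →
                      All P (pairs (xs ++ [ z ])) × All P (pairs (z ∷ ys))
    All-pairs-++-∷⁻ xs z ys ps = All.++⁻ (pairs (xs ++ [ z ])) (subst (All P) (pairs-++-∷ xs z ys) ps)

    All-pairs-++-∷⁺ : ∀ xs (z : A) ys → All P (pairs (xs ++ [ z ])) → All P (pairs (z ∷ ys)) →
                      All P (pairs (xs ++ z ∷ ys))
    All-pairs-++-∷⁺ xs z ys ps qs = subst (All P) (sym (pairs-++-∷ xs z ys)) (All.++⁺ ps qs)

  pairs-proj₂-∈ : (l : List A) → All (λ p → proj₂ p ∈ l) (pairs l)
  pairs-proj₂-∈ []          = []
  pairs-proj₂-∈ (x ∷ [])    = []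
  pairs-proj₂-∈ (x ∷ y ∷ l) = there (here refl) ∷ All.map there (pairs-proj₂-∈ (y ∷ l))

  last-pair-∈ : (x : A) (xs : List A) (y : A) → ∃ λ u → (u , y) ∈ pairs (x ∷ xs ++ [ y ])
  last-pair-∈ x []       y = x , here refl
  last-pair-∈ x (z ∷ xs) y = Product.map₂ there (last-pair-∈ z xs y)

  Unique-++⁻ˡ : ∀ (xs : List A) {ys} → Unique (xs ++ ys) → Unique xs
  Unique-++⁻ˡ []       _          = []
  Unique-++⁻ˡ (x ∷ xs) (x∉ ∷ xs!) = All.++⁻ˡ xs x∉ ∷ Unique-++⁻ˡ xs xs!

  Unique-++⁻ʳ : ∀ (xs : List A) {ys} → Unique (xs ++ ys) → Unique ys
  Unique-++⁻ʳ []       ys!       = ys!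
  Unique-++⁻ʳ (x ∷ xs) (_ ∷ xs!) = Unique-++⁻ʳ xs xs!

  ¬Unique-closed : ∀ (x : A) xs → ¬ Unique (x ∷ xs ++ [ x ])
  ¬Unique-closed x xs (x∉ ∷ _) = All.lookup x∉ (∈-++⁺ʳ xs (here refl)) refl

  lookup-injective : ∀ {xs : List A} → Unique xs → Injective _≡_ _≡_ (lookup xs)
  lookup-injective (_  ∷ _)   {Fin.zero}  {Fin.zero}  _  = refl
  lookup-injective (x∉ ∷ _)   {Fin.zero}  {Fin.suc j} eq = ⊥-elim (All.lookup x∉ (∈-lookup j) eq)
  lookup-injective (x∉ ∷ _)   {Fin.suc i} {Fin.zero}  eq = ⊥-elim (All.lookup x∉ (∈-lookup i) (sym eq))
  lookup-injective (_  ∷ xs!) {Fin.suc i} {Fin.suc j} eq = cong Fin.suc (lookup-injective xs! eq)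

Unique⇒length≤ : ∀ {n} {xs : List (Fin n)} → Unique xs → length xs ≤ n
Unique⇒length≤ xs! = injective⇒≤ (lookup-injective xs!)

module ClassPaths {n m k : ℕ} (D : Digraph n) (H : Digraph m) (c : Fin n → Fin n → Fin m) (part : Fin m → Fin k)
  where

  open import Data.List.Membership.DecPropositional (_≟_ {n}) using (_∈?_)

  Arcs : List (Fin n) → Set
  Arcs l = All (λ { (u , v) → D u v ≡ true }) (pairs l)

  Path : List (Fin n) → Set
  Path l = Unique l × Arcs l

  NoArcOfClassInto : Fin k → Fin n → List (Fin n) → Set
  NoArcOfClassInto i z l = All (λ { (u , v) → v ≡ z → part (c u v) ≢ i }) (pairs l)

  ClassHPath : Fin k → Fin n → Fin n → Set
  ClassHPath i = HPathIn D H c (λ u v → part (c u v) ≡ i)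

  SingleClassCycles : Set
  SingleClassCycles = ∀ γ → IsCycle D H c γ → ∃ λ i → ContainedIn D H c part i γ

  SingleClassHWalks : Set
  SingleClassHWalks = ∀ P → IsHWalk D H c P → ∃ λ j → ContainedIn D H c part j P

  HPath-irreflexive : ∀ {a} → ¬ HPath D H c a a
  HPath-irreflexive {a} (mid , _ , a!) = ¬Unique-closed a mid a!

  ClassHPath⇒HPath : ∀ {i a b} → ClassHPath i a b → HPath D H c a b
  ClassHPath⇒HPath (mid , hpath , _) = mid , hpath

  ClassHPath-path : ∀ {i a b} (ρ : ClassHPath i a b) → Path (a ∷ proj₁ ρ ++ [ b ])
  ClassHPath-path (_ , (((_ , arcs) , _) , a!) , _) = a! , arcs

  HPath⇒ClassHPath : SingleClassHWalks → ∀ {a b} → HPath D H c a b → ∃ λ i → ClassHPath i a b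
  HPath⇒ClassHPath walks (mid , hpath) with j , inj ← walks _ (proj₁ hpath) = j , mid , hpath , inj

  junction-cycle : ∀ w z β γ → Path (w ∷ β ++ [ z ]) → Unique γ → All (_∉ w ∷ β ++ [ z ]) γ →
                   Arcs (z ∷ γ ++ [ w ]) → IsCycle D H c (w ∷ β ++ z ∷ γ ++ [ w ])
  junction-cycle w z β γ (wβz! , wβz-arcs) γ! γ-fresh zγw-arcs = w , β ++ z ∷ γ , closed , walk , cycle!
    where
      closed : w ∷ β ++ z ∷ γ ++ [ w ] ≡ w ∷ (β ++ z ∷ γ) ++ [ w ]
      closed = cong (w ∷_) (sym (++-assoc β (z ∷ γ) [ w ]))
      walk : IsWalk D H c (w ∷ β ++ z ∷ γ ++ [ w ])
      walk = s≤s (≤-trans (s≤s z≤n) (length-++-≤ʳ (z ∷ γ ++ [ w ]) {β}))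
           , All-pairs-++-∷⁺ (w ∷ β) z (γ ++ [ w ]) wβz-arcs zγw-arcs
      cycle! : Unique (w ∷ β ++ z ∷ γ)
      cycle! = subst Unique (++-assoc (w ∷ β) [ z ] γ)
                 (Unique.++⁺ wβz! γ! λ (v∈wβz , v∈γ) → All.lookup γ-fresh v∈γ v∈wβz)

  module _ (cycles : SingleClassCycles) where

    -- The arc of the cycle leaving z has class i, the one entering z has not.
    ¬junction-cycle : ∀ {i} w z β γ →
      Path (w ∷ β ++ [ z ]) → NoArcOfClassInto i z (w ∷ β ++ [ z ]) →
      Unique γ → All (_∉ w ∷ β ++ [ z ]) γ →
      Arcs (z ∷ γ ++ [ w ]) → ContainedIn D H c part i (z ∷ γ ++ [ w ]) → ⊥
    ¬junction-cycle w z β γ wβz wβz-entry γ! γ-fresh zγw-arcs zγw-class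
      with i₀ , cycle-class ← cycles _ (junction-cycle w z β γ wβz γ! γ-fresh zγw-arcs)
      with wβz-class , zγw-class₀ ← All-pairs-++-∷⁻ (w ∷ β) z (γ ++ [ w ]) cycle-class
      with u , uz∈ ← last-pair-∈ w β z
      with u′ , u′w∈ ← last-pair-∈ z γ w
      = All.lookup wβz-entry uz∈ refl
          (trans (All.lookup wβz-class uz∈)
            (trans (sym (All.lookup zγw-class₀ u′w∈)) (All.lookup zγw-class u′w∈)))

    extension-avoids-path : ∀ {i} π z q →
      Path (π ++ [ z ]) → NoArcOfClassInto i z (π ++ [ z ]) →
      Path (z ∷ q) → ContainedIn D H c part i (z ∷ q) →
      All (_∉ π ++ [ z ]) q
    extension-avoids-path π z q πz πz-entry (z∉q ∷ q! , zq-arcs) zq-class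
      with first (λ v → Sum.swap (toSum (v ∈? π ++ [ z ]))) q
    ... | inj₂ q-fresh = q-fresh
    ... | inj₁ meet with toView meet
    ...   | First._++_∷_ {γ} {w} γ-fresh w∈πz δ
      with ∈-++⁻ π w∈πz
    ...     | inj₂ (here refl) = ⊥-elim (All.lookup z∉q (∈-++⁺ʳ γ (here refl)) refl)
    ...     | inj₁ w∈π
      with α , β , refl ← ∈-∃++ w∈π
      = ⊥-elim (¬junction-cycle w z β γ
          (Unique-++⁻ʳ α (proj₁ αwβz) , proj₂ (All-pairs-++-∷⁻ α w (β ++ [ z ]) (proj₂ αwβz)))
          (proj₂ (All-pairs-++-∷⁻ α w (β ++ [ z ]) (subst (NoArcOfClassInto _ z) split πz-entry)))
          (Unique-++⁻ˡ γ q!)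
          (All.map (λ v∉πz v∈wβz → v∉πz (subst (_ ∈_) (sym split) (∈-++⁺ʳ α v∈wβz))) γ-fresh)
          (proj₁ (All-pairs-++-∷⁻ (z ∷ γ) w δ zq-arcs))
          (proj₁ (All-pairs-++-∷⁻ (z ∷ γ) w δ zq-class)))
      where
        split : (α ++ w ∷ β) ++ [ z ] ≡ α ++ w ∷ β ++ [ z ]
        split = ++-assoc α (w ∷ β) [ z ]
        αwβz : Path (α ++ w ∷ β ++ [ z ])
        αwβz = subst Path split πz

    extend-path : ∀ {i j} π z q y → j ≢ i →
      Path (π ++ [ z ]) → NoArcOfClassInto i z (π ++ [ z ]) →
      Path (z ∷ q ++ [ y ]) → ContainedIn D H c part i (z ∷ q ++ [ y ]) →
      Path ((π ++ z ∷ q) ++ [ y ]) × NoArcOfClassInto j y ((π ++ z ∷ q) ++ [ y ])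
    extend-path {j = j} π z q y j≢i πz πz-entry zqy zqy-class =
      subst (λ l → Path l × NoArcOfClassInto j y l) (sym (++-assoc π (z ∷ q) [ y ]))
        ( ( subst Unique (++-assoc π [ z ] (q ++ [ y ]))
              (Unique.++⁺ (proj₁ πz) qy! λ (v∈πz , v∈qy) → All.lookup qy-fresh v∈qy v∈πz)
          , All-pairs-++-∷⁺ π z (q ++ [ y ]) (proj₂ πz) (proj₂ zqy) )
        , All-pairs-++-∷⁺ π z (q ++ [ y ])
            (All.map (λ v∈πz v≡y _ →
                        All.lookup qy-fresh (∈-++⁺ʳ q (here refl)) (subst (_∈ π ++ [ z ]) v≡y v∈πz))
              (pairs-proj₂-∈ (π ++ [ z ])))
            (All.map (λ class≡i _ class≡j → j≢i (trans (sym class≡j) class≡i)) zqy-class) )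
      where
        qy-fresh : All (_∉ π ++ [ z ]) (q ++ [ y ])
        qy-fresh = extension-avoids-path π z (q ++ [ y ]) πz πz-entry zqy zqy-class
        qy! : Unique (q ++ [ y ])
        qy! = Unique-++⁻ʳ [ z ] (proj₁ zqy)

module _ {n m k : ℕ} (D : Digraph n) (H : Digraph m) (c : Fin n → Fin n → Fin m) (part : Fin m → Fin k)
  (transitive : ∀ i → TransitiveByHPaths D H c part i)
  (cycles : ClassPaths.SingleClassCycles D H c part)
  (walks : ClassPaths.SingleClassHWalks D H c part)
  (x : ℕ → Fin n)
  (forward : ∀ l → HPath D H c (x l) (x (suc l)))
  (backward : ∀ l → ¬ HPath D H c (x (suc l)) (x l))
  where

  open ClassPaths D H c part

  stepClass : ℕ → Fin k
  stepClass l = proj₁ (HPath⇒ClassHPath walks (forward l))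

  step : ∀ l → ClassHPath (stepClass l) (x l) (x (suc l))
  step l = proj₂ (HPath⇒ClassHPath walks (forward l))

  data Run (i : Fin k) (p : ℕ) : ℕ → Set where
    []   : Run i p 0
    _∷ʳ_ : ∀ {r} → Run i p r → stepClass (r + p) ≡ i → Run i p (suc r)

  RunInjective : ℕ → ℕ → Set
  RunInjective p r = ∀ {a b} → a < b → b ≤ r → x (a + p) ≢ x (b + p)

  RunReachesEnd : Fin k → ℕ → ℕ → Set
  RunReachesEnd i p r = ∀ a → a < r → ClassHPath i (x (a + p)) (x (r + p))

  run-properties : ∀ {i p} r → Run i p r → RunInjective p r × RunReachesEnd i p r
  run-properties zero [] = (λ { () z≤n }) , λ _ ()
  run-properties {i} {p} (suc r) (run ∷ʳ refl) = injective , reaches-end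
    where
      injective₀ : RunInjective p r
      injective₀ = proj₁ (run-properties r run)
      reaches₀ : RunReachesEnd i p r
      reaches₀ = proj₂ (run-properties r run)

      reach-end : ∀ a → a ≤ r → x (a + p) ≢ x (suc r + p) →
                  ClassHPath i (x (a + p)) (x (suc r + p))
      reach-end a a≤r a≢end with m≤n⇒m<n∨m≡n a≤r
      ... | inj₁ a<r  = transitive i _ _ _ a≢end (reaches₀ a a<r) (step (r + p))
      ... | inj₂ refl = step (r + p)

      fresh-end : ∀ a → a ≤ r → x (a + p) ≢ x (suc r + p)
      fresh-end a a≤r a≡end with m≤n⇒m<n∨m≡n a≤r
      ... | inj₂ refl = HPath-irreflexive
                          (subst (HPath D H c _) (sym a≡end) (ClassHPath⇒HPath (step (r + p))))
      ... | inj₁ a<r  = backward (a + p) (subst (HPath D H c _) (sym a≡end)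
                          (ClassHPath⇒HPath (reach-end (suc a) a<r
                            λ 1+a≡end → injective₀ (n<1+n a) a<r (trans a≡end (sym 1+a≡end)))))

      injective : RunInjective p (suc r)
      injective {a} a<b b≤1+r with m≤n⇒m<n∨m≡n b≤1+r
      ... | inj₁ b<1+r = injective₀ a<b (s≤s⁻¹ b<1+r)
      ... | inj₂ refl  = fresh-end a (s≤s⁻¹ a<b)

      reaches-end : RunReachesEnd i p (suc r)
      reaches-end a a<1+r = reach-end a (s≤s⁻¹ a<1+r) (fresh-end a (s≤s⁻¹ a<1+r))

  run-length : ∀ {i p} r → Run i p r → r < n
  run-length {p = p} r run =
    subst (_≤ n) (length-applyUpTo (λ a → x (a + p)) (suc r))
      (Unique⇒length≤ (Unique.applyUpTo⁺₁ (λ a → x (a + p)) (suc r)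
        λ a<b b<1+r → proj₁ (run-properties r run) a<b (s≤s⁻¹ b<1+r)))

  -- The state after step t: the current run has class runClass and covers the steps start … t, and
  -- trail ++ [ x start ] is the path in D obtained by joining the earlier runs. Each finished run
  -- took at most n steps and lengthened the trail, whence the budget.
  record Stage (t : ℕ) : Set where
    field
      trail       : List (Fin n)
      start run   : ℕ
      runClass    : Fin k
      now         : t ≡ run + start
      current-run : Run runClass start (suc run)
      path        : Path (trail ++ [ x start ])
      entry       : NoArcOfClassInto runClass (x start) (trail ++ [ x start ])
      budget      : start ≤ length trail * n

  initial-stage : Stage 0
  initial-stage = record
    { trail = [] ; start = 0 ; run = 0 ; runClass = stepClass 0 ; now = refl
    ; current-run = [] ∷ʳ refl ; path = ([] ∷ []) , [] ; entry = [] ; budget = z≤n }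

  next-stage : ∀ {t} → Stage t → Stage (suc t)
  next-stage s with stepClass (suc (Stage.run s) + Stage.start s) ≟ Stage.runClass s
  ... | yes same = record
    { trail = trail ; start = start ; run = suc run ; runClass = runClass ; now = cong suc now
    ; current-run = current-run ∷ʳ same ; path = path ; entry = entry ; budget = budget }
    where open Stage s
  ... | no differ = record
    { trail = trail′ ; start = suc run + start ; run = 0 ; runClass = stepClass (suc run + start)
    ; now = cong suc now ; current-run = [] ∷ʳ refl ; path = proj₁ joined ; entry = proj₂ joined
    ; budget = budget′ }
    where
      open Stage s
      run-path : ClassHPath runClass (x start) (x (suc run + start))
      run-path = proj₂ (run-properties (suc run) current-run) 0 (s≤s z≤n)
      trail′ : List (Fin n)
      trail′ = trail ++ x start ∷ proj₁ run-path
      joined : Path (trail′ ++ [ x (suc run + start) ])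
             × NoArcOfClassInto (stepClass (suc run + start)) (x (suc run + start))
                                (trail′ ++ [ x (suc run + start) ])
      joined = extend-path cycles trail (x start) (proj₁ run-path) (x (suc run + start)) differ
                 path entry (ClassHPath-path run-path) (proj₂ (proj₂ run-path))
      budget′ : suc run + start ≤ length trail′ * n
      budget′ = ≤-trans (+-mono-≤ (<⇒≤ (run-length (suc run) current-run)) budget)
                  (*-monoˡ-≤ n (subst (suc (length trail) ≤_)
                    (sym (length-++-sucʳ trail (x start) (proj₁ run-path))) (s≤s (length-++-≤ˡ trail))))

  stage : ∀ t → Stage t
  stage zero    = initial-stage
  stage (suc t) = next-stage (stage t)

  stage-bound : ∀ {t} → Stage t → t < n + n * n
  stage-bound s = subst (_< n + n * n) (sym now)
                    (+-mono-<-≤ (<⇒≤ (run-length (suc run) current-run))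
                                (≤-trans budget (*-monoˡ-≤ n trail≤n)))
    where
      open Stage s
      trail≤n : length trail ≤ n
      trail≤n = ≤-trans (length-++-≤ˡ trail) (Unique⇒length≤ (proj₁ path))

  no-infinite-chain : ⊥
  no-infinite-chain = <-irrefl refl (stage-bound (stage (n + n * n)))

mainTheorem5 : (n m k : ℕ) (D : Digraph n) (H : Digraph m) (c : Fin n → Fin n → Fin m)
    → (∀ v → D v v ≡ false)
    → (∀ v → ∃ (λ u → (D v u ≡ true) ⊎ (D u v ≡ true)))
    → 2 ≤ k
    → (part : Fin m → Fin k)
    → Surjective _≡_ _≡_ part
    → (∀ i → ∃ (λ u → ∃ (λ v → InA D H c part i u v)))
    → (∀ i → TransitiveByHPaths D H c part i)
    → (∀ (γ : List (Fin n)) → IsCycle D H c γ → ∃ (λ i → ContainedIn D H c part i γ))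
    → (∀ (P : List (Fin n)) → IsHWalk D H c P → ∃ (λ j → ContainedIn D H c part j P))
    → ¬ (Σ (ℕ → Fin n) λ x → ∀ i → HPath D H c (x i) (x (suc i)) × ¬ HPath D H c (x (suc i)) (x i))
mainTheorem5 n m k D H c _ _ _ part _ _ transitive cycles walks (x , steps) =
  no-infinite-chain D H c part transitive cycles walks x (proj₁ ∘ steps) (proj₂ ∘ steps)
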